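{- Let $G$ be a finite simple $r$-regular graph. If $r$ is odd, then $\gamma^{0}_{st}(G) = -\gamma_{st}(G)$, and if $r$ is even, then $\gamma^{0}_{st}(G) = \alpha^{2}_{st}(G)$.
   Context: For a vertex $v$, $N(v)$ denotes its open neighborhood. For $f: V(G) \to \mathbb{R}$ and $B \subseteq V(G)$ write $f(B) = \sum_{v \in B} f(v)$; $f(V(G))$ is the weight of $f$. An inverse signed total dominating function (ISTDF) is a function $f: V(G) \to \{ -1,1\}$ with $f(N(v)) \leq 0$ for every vertex $v$; $\gamma^{0}_{st}(G)$ is the maximum weight of an ISTDF. A signed total dominating function (STDF) is a function $f: V(G) \to \{ -1,1\}$ with $f(N(v)) \geq 1$ for every vertex $v$; the signed total domination number $\gamma_{st}(G)$ is the minimum weight of an STDF. A signed total $2$-independence function is a function $f: V(G) \to \{ -1,1\}$ with $f(N(v)) \leq 1$ for every vertex $v$; the signed total $2$-independence number $\alpha^{2}_{st}(G)$ is the maximum weight of such a function. -}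

module Defs where

open import Data.Bool using (Bool; true; false; if_then_else_)
open import Data.Nat as ℕ using (ℕ)
open import Data.Integer as ℤ using (ℤ; +_; -_; _≤_)
open import Data.Fin using (Fin)
open import Data.List using (List; foldr; map; filterᵇ; length; allFin)
open import Data.Product using (Σ; _×_)
open import Relation.Binary.PropositionalEquality using (_≡_)

record SimpleGraph (n : ℕ) : Set where
  field
    adj   : Fin n → Fin n → Bool
    sym   : ∀ u v → adj u v ≡ adj v u
    loopless : ∀ v → adj v v ≡ false
open SimpleGraph public

N : ∀ {n} → SimpleGraph n → Fin n → List (Fin n)
N {n} G v = filterᵇ (adj G v) (allFin n)

degree : ∀ {n} → SimpleGraph n → Fin n → ℕ
degree G v = length (N G v)

Regular : ∀ {n} → SimpleGraph n → ℕ → Set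
Regular {n} G r = ∀ (v : Fin n) → degree G v ≡ r

sumℤ : List ℤ → ℤ
sumℤ = foldr ℤ._+_ (+ 0)

-- functions V(G) → {-1,1}: true ↦ 1, false ↦ -1
PMFun : ℕ → Set
PMFun n = Fin n → Bool

val : Bool → ℤ
val true  = + 1
val false = - (+ 1)

fSum : ∀ {n} → PMFun n → List (Fin n) → ℤ
fSum f B = sumℤ (map (λ u → val (f u)) B)

weight : ∀ {n} → PMFun n → ℤ
weight {n} f = fSum f (allFin n)

IsISTDF : ∀ {n} → SimpleGraph n → PMFun n → Set
IsISTDF {n} G f = ∀ (v : Fin n) → fSum f (N G v) ≤ + 0

IsSTDF : ∀ {n} → SimpleGraph n → PMFun n → Set
IsSTDF {n} G f = ∀ (v : Fin n) → + 1 ≤ fSum f (N G v)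

IsST2IF : ∀ {n} → SimpleGraph n → PMFun n → Set
IsST2IF {n} G f = ∀ (v : Fin n) → fSum f (N G v) ≤ + 1

IsMaxWeight : ∀ {n} → (PMFun n → Set) → ℤ → Set
IsMaxWeight {n} P w =
  Σ (PMFun n) (λ f → P f × weight f ≡ w) × (∀ f → P f → weight f ≤ w)

IsMinWeight : ∀ {n} → (PMFun n → Set) → ℤ → Set
IsMinWeight {n} P w =
  Σ (PMFun n) (λ f → P f × weight f ≡ w) × (∀ f → P f → w ≤ weight f)

γ⁰st≡ : ∀ {n} → SimpleGraph n → ℤ → Set
γ⁰st≡ G = IsMaxWeight (IsISTDF G)

γst≡ : ∀ {n} → SimpleGraph n → ℤ → Set
γst≡ G = IsMinWeight (IsSTDF G)

α²st≡ : ∀ {n} → SimpleGraph n → ℤ → Set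
α²st≡ G = IsMaxWeight (IsST2IF G)

-- Every sum f(N(v)) of r terms ±1 has the parity of r.  For odd r it is never 0, so
-- f(N(v)) ≤ 0 forces f(N(v)) ≤ -1, i.e. -f is a signed total dominating function, and
-- negation is a weight-reversing bijection between ISTDFs and STDFs.  For even r it
-- is never 1, so the conditions f(N(v)) ≤ 0 and f(N(v)) ≤ 1 coincide.
module Submission where

open import Defs
open import Data.Nat using (ℕ; _%_)
open import Data.Integer using (ℤ; -_)
open import Data.Product using (_×_)
open import Function.Bundles using (_⇔_)
open import Relation.Binary.PropositionalEquality using (_≡_)

open import Data.Bool using (true; false; not)
open import Data.Fin using (Fin)
open import Data.List using (List; []; _∷_; length; allFin)
import Data.Nat as ℕ
import Data.Nat.DivMod as ℕ
import Data.Nat.Properties as ℕ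
open import Data.Integer using (+_; _+_; _≤_; +≤+; -≤+)
import Data.Integer.Properties as ℤ
open import Data.Integer.Tactic.RingSolver using (solve-∀)
open import Data.Product using (∃; _,_)
open import Function.Bundles using (mk⇔; Equivalence)
import Function.Properties.Equivalence as ⇔
open import Relation.Binary.PropositionalEquality
  using (_≢_; refl; trans; cong; cong₂; subst; subst₂; module ≡-Reasoning)
  renaming (sym to ≡-sym)

private
  variable
    n r : ℕ

negate : PMFun n → PMFun n
negate f v = not (f v)

fSum-negate : (f : PMFun n) (B : List (Fin n)) → fSum (negate f) B ≡ - fSum f B
fSum-negate f [] = refl
fSum-negate f (u ∷ B) = begin
  val (not (f u)) + fSum (negate f) B  ≡⟨ cong₂ _+_ (val-not (f u)) (fSum-negate f B) ⟩
  - val (f u) + - fSum f B             ≡⟨ ≡-sym (ℤ.neg-distrib-+ (val (f u)) (fSum f B)) ⟩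
  - (val (f u) + fSum f B)             ∎
  where
  open ≡-Reasoning
  val-not : ∀ b → val (not b) ≡ - val b
  val-not true  = refl
  val-not false = refl

weight-negate : (f : PMFun n) → weight (negate f) ≡ - weight f
weight-negate {n} f = fSum-negate f (allFin n)

fSum+length-even : (f : PMFun n) (B : List (Fin n)) →
                   ∃ λ c → fSum f B + + length B ≡ + (c ℕ.* 2)
fSum+length-even f [] = 0 , refl
fSum+length-even f (u ∷ B) with fSum+length-even f B | f u
... | c , eq | true  = ℕ.suc c , trans (plus-one (fSum f B) (+ length B)) (cong (_+_ (+ 2)) eq)
  where
  plus-one : ∀ s l → (+ 1 + s) + (+ 1 + l) ≡ + 2 + (s + l)
  plus-one = solve-∀
... | c , eq | false = c , trans (minus-one (fSum f B) (+ length B)) eq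
  where
  minus-one : ∀ s l → (- + 1 + s) + (+ 1 + l) ≡ s + l
  minus-one = solve-∀

fSum≢0-if-odd : (f : PMFun n) (B : List (Fin n)) → length B % 2 ≡ 1 → fSum f B ≢ + 0
fSum≢0-if-odd f B odd fB≡0 with fSum+length-even f B
... | c , eq rewrite fB≡0 = ℕ.0≢1+n (begin
  0                ≡⟨ ≡-sym (ℕ.m*n%n≡0 c 2) ⟩
  (c ℕ.* 2) % 2    ≡⟨ cong (_% 2) (≡-sym (ℤ.+-injective eq)) ⟩
  length B % 2     ≡⟨ odd ⟩
  1                ∎)
  where open ≡-Reasoning

fSum≢1-if-even : (f : PMFun n) (B : List (Fin n)) → length B % 2 ≡ 0 → fSum f B ≢ + 1
fSum≢1-if-even f B even fB≡1 with fSum+length-even f B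
... | c , eq rewrite fB≡1 = ℕ.0≢1+n (begin
  0                             ≡⟨ ≡-sym (ℕ.m*n%n≡0 c 2) ⟩
  (c ℕ.* 2) % 2                 ≡⟨ cong (_% 2) (≡-sym (ℤ.+-injective eq)) ⟩
  (1 ℕ.+ length B) % 2          ≡⟨ ℕ.%-distribˡ-+ 1 (length B) 2 ⟩
  (1 ℕ.+ length B % 2) % 2      ≡⟨ cong (λ k → (1 ℕ.+ k) % 2) even ⟩
  1                             ∎)
  where open ≡-Reasoning

≤0∧≢0⇒1≤- : ∀ {z} → z ≤ + 0 → z ≢ + 0 → + 1 ≤ - z
≤0∧≢0⇒1≤- z≤0 z≢0 = ℤ.i<j⇒suc[i]≤j (ℤ.neg-mono-< (ℤ.≤∧≢⇒< z≤0 z≢0))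

≤1∧≢1⇒≤0 : ∀ {z} → z ≤ + 1 → z ≢ + 1 → z ≤ + 0
≤1∧≢1⇒≤0 z≤1 z≢1 = ℤ.i<j⇒i≤pred[j] (ℤ.≤∧≢⇒< z≤1 z≢1)

1≤⇒-≤0 : ∀ {z} → + 1 ≤ z → - z ≤ + 0
1≤⇒-≤0 1≤z = ℤ.≤-trans (ℤ.neg-mono-≤ 1≤z) -≤+

module _ {P Q : PMFun n → Set} {w : ℤ} where

  IsMaxWeight-cong : (∀ f → P f ⇔ Q f) → IsMaxWeight P w ⇔ IsMaxWeight Q w
  IsMaxWeight-cong P⇔Q = mk⇔ (transport P⇔Q) (transport (λ f → ⇔.sym (P⇔Q f)))
    where
    transport : ∀ {R S} → (∀ f → R f ⇔ S f) → IsMaxWeight R w → IsMaxWeight S w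
    transport R⇔S ((f , Rf , wf) , max) =
      (f , Equivalence.to (R⇔S f) Rf , wf) , λ g Sg → max g (Equivalence.from (R⇔S g) Sg)

  IsMaxWeight⇔IsMinWeight-negate : (∀ f → P f → Q (negate f)) → (∀ f → Q f → P (negate f)) →
                                   IsMaxWeight P w ⇔ IsMinWeight Q (- w)
  IsMaxWeight⇔IsMinWeight-negate P⇒Q Q⇒P = mk⇔ to from
    where
    to : IsMaxWeight P w → IsMinWeight Q (- w)
    to ((f , Pf , wf) , max) =
        (negate f , P⇒Q f Pf , trans (weight-negate f) (cong -_ wf))
      , λ g Qg → subst (- w ≤_) (ℤ.neg-involutive (weight g))
                   (ℤ.neg-mono-≤ (subst (_≤ w) (weight-negate g) (max (negate g) (Q⇒P g Qg))))
    from : IsMinWeight Q (- w) → IsMaxWeight P w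
    from ((f , Qf , wf) , min) =
        (negate f , Q⇒P f Qf , trans (weight-negate f) (trans (cong -_ wf) (ℤ.neg-involutive w)))
      , λ g Pg → subst₂ _≤_ (ℤ.neg-involutive (weight g)) (ℤ.neg-involutive w)
                   (ℤ.neg-mono-≤ (subst (- w ≤_) (weight-negate g) (min (negate g) (P⇒Q g Pg))))

module _ (G : SimpleGraph n) where

  IsSTDF⇒IsISTDF-negate : ∀ f → IsSTDF G f → IsISTDF G (negate f)
  IsSTDF⇒IsISTDF-negate f stdf v =
    subst (_≤ + 0) (≡-sym (fSum-negate f (N G v))) (1≤⇒-≤0 (stdf v))

  IsISTDF⇒IsST2IF : ∀ f → IsISTDF G f → IsST2IF G f
  IsISTDF⇒IsST2IF f istdf v = ℤ.≤-trans (istdf v) (+≤+ ℕ.z≤n)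

  module _ (regular : Regular G r) where

    IsISTDF⇒IsSTDF-negate : r % 2 ≡ 1 → ∀ f → IsISTDF G f → IsSTDF G (negate f)
    IsISTDF⇒IsSTDF-negate odd f istdf v =
      subst (+ 1 ≤_) (≡-sym (fSum-negate f (N G v)))
        (≤0∧≢0⇒1≤- (istdf v) (fSum≢0-if-odd f (N G v) (trans (cong (_% 2) (regular v)) odd)))

    IsST2IF⇒IsISTDF : r % 2 ≡ 0 → ∀ f → IsST2IF G f → IsISTDF G f
    IsST2IF⇒IsISTDF even f st2if v =
      ≤1∧≢1⇒≤0 (st2if v) (fSum≢1-if-even f (N G v) (trans (cong (_% 2) (regular v)) even))

mainTheorem3 : ∀ (n r : ℕ) (G : SimpleGraph n) → Regular G r →
    ((r % 2 ≡ 1) → ∀ (w : ℤ) → γ⁰st≡ G w ⇔ γst≡ G (- w)) ×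
    ((r % 2 ≡ 0) → ∀ (w : ℤ) → γ⁰st≡ G w ⇔ α²st≡ G w)
mainTheorem3 n r G regular =
    (λ odd w → IsMaxWeight⇔IsMinWeight-negate
                 (IsISTDF⇒IsSTDF-negate G regular odd) (IsSTDF⇒IsISTDF-negate G))
  , (λ even w → IsMaxWeight-cong λ f →
                  mk⇔ (IsISTDF⇒IsST2IF G f) (IsST2IF⇒IsISTDF G regular even f))
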